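{- Let $M$ be a uniform matroid of rank $r$ on $E=\{e_1,\dots,e_n\}$, $k\ge1$, and let each $e_i$ be active independently with probability $p_i$, where $p_1\ge\dots\ge p_n$; let $A$ be the random set of active elements. Assume $\mathrm{OPT}\ge200$. Let $M^*$ be the largest index with $\sum_{i=1}^{M^*}p_i<\mathrm{OPT}/2$ and $H=\{e_1,\dots,e_{M^*}\}$. Then $$\Pr\Big[|A\cap H|\ge\frac{\mathrm{OPT}}{12}\Big]\ge\frac12.$$
   Context: A portfolio is a collection of $k$ subsets of $E$ each of size at most $r$, with value $\mathbb{E}_A[\max_i|S_i\cap A|]$; $\mathrm{OPT}$ is the maximum value over portfolios.
   Formalization: The activation probabilities $p_i$ are rational, so OPT is rational as well. -}

module Defs where

open import Data.Bool using (Bool; true; false; if_then_else_)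
open import Data.Nat as ℕ using (ℕ; zero; suc; _⊔_; _<ᵇ_)
open import Data.Integer using (+_)
open import Data.Fin using (Fin; toℕ)
open import Data.Fin.Subset using (Subset; _∩_; ∣_∣)
open import Data.Vec using ([]; _∷_; tabulate)
open import Data.List using (List; []; _∷_; map; _++_; foldr; allFin)
open import Data.Rational using (ℚ; 0ℚ; 1ℚ; _+_; _*_; _-_; _/_)
import Data.Rational as ℚ
open import Data.Product using (Σ; ∃; _×_; proj₁)
open import Relation.Binary.PropositionalEquality using (_≡_)

ℕ→ℚ : ℕ → ℚ
ℕ→ℚ m = + m / 1

sumℚ : List ℚ → ℚ
sumℚ = foldr _+_ 0ℚ

-- all 2^n subsets of E = Fin n  (element e_{i+1} is index i : Fin n)
allSubsets : (n : ℕ) → List (Subset n)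
allSubsets zero = [] ∷ []
allSubsets (suc n) = map (true ∷_) (allSubsets n) ++ map (false ∷_) (allSubsets n)

probExactly : ∀ {n} → (Fin n → ℚ) → Subset n → ℚ
probExactly {zero} p [] = 1ℚ
probExactly {suc n} p (b ∷ A) =
  (if b then p Fin.zero else 1ℚ - p Fin.zero) * probExactly (λ i → p (Fin.suc i)) A
  where import Data.Fin as Fin

expect : ∀ {n} → (Fin n → ℚ) → (Subset n → ℚ) → ℚ
expect {n} p f = sumℚ (map (λ A → probExactly p A * f A) (allSubsets n))

Pr : ∀ {n} → (Fin n → ℚ) → (Subset n → Bool) → ℚ
Pr p P = expect p (λ A → if P A then 1ℚ else 0ℚ)

maxFin : ∀ k → (Fin k → ℕ) → ℕ
maxFin zero f = 0
maxFin (suc k) f = f Fin.zero ⊔ maxFin k (λ i → f (Fin.suc i))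
  where import Data.Fin as Fin

IndepUniform : ∀ {n} → ℕ → Subset n → Set
IndepUniform r S = ∣ S ∣ ℕ.≤ r

Portfolio : ℕ → ℕ → ℕ → Set
Portfolio n k r = Σ (Fin k → Subset n) λ S → ∀ i → IndepUniform r (S i)

value : ∀ {n k r} → (Fin n → ℚ) → Portfolio n k r → ℚ
value {n} {k} p P = expect p (λ A → ℕ→ℚ (maxFin k (λ i → ∣ proj₁ P i ∩ A ∣)))

IsOPT : ∀ n k r → (Fin n → ℚ) → ℚ → Set
IsOPT n k r p OPT =
  (∃ λ (P : Portfolio n k r) → value p P ≡ OPT) × (∀ (P : Portfolio n k r) → value p P ℚ.≤ OPT)

-- H = {e_1, …, e_m} (indices 0 … m-1)
prefixSet : ∀ n → ℕ → Subset n
prefixSet n m = tabulate (λ i → toℕ i <ᵇ m)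

prefixSum : ∀ {n} → (Fin n → ℚ) → ℕ → ℚ
prefixSum {n} p m = sumℚ (map (λ i → if toℕ i <ᵇ m then p i else 0ℚ) (allFin n))

{-# OPTIONS --safe #-}
-- Let X = |A ∩ H|, a sum of independent indicators with mean μ = Σ_{i ≤ M*} p_i and variance
-- at most μ. A portfolio never catches more than all active elements, so OPT ≤ Σ_i p_i; hence
-- M* < n, and maximality of M* together with p_{M*+1} ≤ 1 gives μ ≥ OPT/2 - 1. For
-- t = OPT/12 ≤ μ, pointwise (μ - t)² · [X ≥ t] ≥ (μ - t)² - (X - μ)², so
-- Pr[X ≥ t] ≥ 1 - μ/(μ - t)², which is at least 1/2 because (μ - t)² ≥ 2μ once OPT ≥ 200.
module Submission where

open import Defs
open import Data.Nat as ℕ using (ℕ)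
open import Data.Integer using (+_)
open import Data.Fin as Fin using (Fin)
open import Data.Fin.Subset using (_∩_; ∣_∣)
open import Data.Rational as ℚ using (ℚ; 0ℚ; 1ℚ; ½; _*_; _/_; _≤ᵇ_)
open import Data.Product using (_×_)
open import Relation.Nullary using (¬_)

open import Data.Bool using (Bool; true; false; if_then_else_; T)
open import Data.Nat using (zero; suc; _<ᵇ_)
import Data.Nat.Properties as ℕP
import Data.Integer as ℤ
import Data.Integer.Properties as ℤP
import Data.Nat.Coprimality as Coprimality
open import Data.Fin using (toℕ)
open import Data.Fin.Subset using (Subset; ⊤)
open import Data.Fin.Subset.Properties using (∣p∩q∣≤∣q∣; ∩-identityʳ)
import Data.Vec as Vec
open import Data.Vec using (_∷_; [])
import Data.List as List
open import Data.List using (List; map; _++_)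
import Data.List.Properties as ListP
open import Data.Rational using (_+_; _-_; -_; _≤_; _<_)
import Data.Rational.Properties as ℚP
open import Data.Rational.Solver using (module +-*-Solver)
open import Data.Product using (_,_; proj₁; proj₂)
open import Data.Sum using (inj₁; inj₂)
open import Function using (_∘_; id)
open import Relation.Binary.PropositionalEquality
open +-*-Solver

sq : ℚ → ℚ
sq x = x * x

0≤+ : ∀ {p q} → 0ℚ ≤ p → 0ℚ ≤ q → 0ℚ ≤ p + q
0≤+ = ℚP.+-mono-≤

0≤* : ∀ {p q} → 0ℚ ≤ p → 0ℚ ≤ q → 0ℚ ≤ p * q
0≤* {p} {q} 0≤p 0≤q =
  ℚP.nonNegative⁻¹ (p * q) {{ℚP.nonNeg*nonNeg⇒nonNeg p {{ℚ.nonNegative 0≤p}} q {{ℚ.nonNegative 0≤q}}}}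

p≤q⇒0≤q-p : ∀ {p q} → p ≤ q → 0ℚ ≤ q - p
p≤q⇒0≤q-p {p} {q} p≤q = subst (_≤ q - p) (ℚP.+-inverseʳ p) (ℚP.+-monoˡ-≤ (- p) p≤q)

0≤q-p⇒p≤q : ∀ {p q} → 0ℚ ≤ q - p → p ≤ q
0≤q-p⇒p≤q {p} {q} 0≤q-p =
  subst₂ _≤_ (ℚP.+-identityˡ p) (solve 2 (λ p q → (q :- p) :+ p := q) refl p q) (ℚP.+-monoˡ-≤ p 0≤q-p)

-- Most inequalities p ≤ q below are proved by a ring-solver identity exhibiting q - p as a
-- manifestly nonnegative expression.
≤-by-slack : ∀ {p q} r → q - p ≡ r → 0ℚ ≤ r → p ≤ q
≤-by-slack r q-p≡r 0≤r = 0≤q-p⇒p≤q (subst (0ℚ ≤_) (sym q-p≡r) 0≤r)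

0≤sq : ∀ x → 0ℚ ≤ sq x
0≤sq x with ℚP.≤-total 0ℚ x
... | inj₁ 0≤x = 0≤* 0≤x 0≤x
... | inj₂ x≤0 = subst (0ℚ ≤_) (solve 1 (λ x → (con 0ℚ :- x) :* (con 0ℚ :- x) := x :* x) refl x)
                       (0≤* (p≤q⇒0≤q-p x≤0) (p≤q⇒0≤q-p x≤0))

ℕ→ℚ-suc : ∀ m → ℕ→ℚ (suc m) ≡ 1ℚ + ℕ→ℚ m
ℕ→ℚ-suc m rewrite ℚP.normalize-coprime (Coprimality.sym (Coprimality.1-coprimeTo m)) =
  cong (λ z → (+ 1 ℤ.+ z) / 1) (sym (ℤP.*-identityʳ (+ m)))

0≤ℕ→ℚ : ∀ m → 0ℚ ≤ ℕ→ℚ m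
0≤ℕ→ℚ zero = ℚP.≤-refl
0≤ℕ→ℚ (suc m) rewrite ℕ→ℚ-suc m = 0≤+ {1ℚ} (ℚP.≤ᵇ⇒≤ _) (0≤ℕ→ℚ m)

ℕ→ℚ-mono-≤ : ∀ {m m′} → m ℕ.≤ m′ → ℕ→ℚ m ≤ ℕ→ℚ m′
ℕ→ℚ-mono-≤ {zero} {m′} ℕ.z≤n = 0≤ℕ→ℚ m′
ℕ→ℚ-mono-≤ {suc m} {suc m′} (ℕ.s≤s m≤m′) rewrite ℕ→ℚ-suc m | ℕ→ℚ-suc m′ =
  ℚP.+-monoʳ-≤ 1ℚ (ℕ→ℚ-mono-≤ m≤m′)

-- Expectation over independent activations

sumℚ-++ : (xs ys : List ℚ) → sumℚ (xs ++ ys) ≡ sumℚ xs + sumℚ ys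
sumℚ-++ List.[] ys = sym (ℚP.+-identityˡ (sumℚ ys))
sumℚ-++ (x List.∷ xs) ys rewrite sumℚ-++ xs ys = sym (ℚP.+-assoc x (sumℚ xs) (sumℚ ys))

sumℚ-*ˡ : ∀ {X : Set} a (f : X → ℚ) (xs : List X) → sumℚ (map (λ x → a * f x) xs) ≡ a * sumℚ (map f xs)
sumℚ-*ˡ a f List.[] = sym (ℚP.*-zeroʳ a)
sumℚ-*ˡ a f (x List.∷ xs) rewrite sumℚ-*ˡ a f xs = sym (ℚP.*-distribˡ-+ a (f x) (sumℚ (map f xs)))

Probabilities : ∀ {n} → (Fin n → ℚ) → Set
Probabilities p = ∀ i → (0ℚ ≤ p i) × (p i ≤ 1ℚ)

mix : ℚ → ℚ → ℚ → ℚ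
mix q x y = q * x + (1ℚ - q) * y

mix-mono-≤ : ∀ {q x x′ y y′} → 0ℚ ≤ q → q ≤ 1ℚ → x ≤ x′ → y ≤ y′ → mix q x y ≤ mix q x′ y′
mix-mono-≤ {q} {x} {x′} {y} {y′} 0≤q q≤1 x≤x′ y≤y′ =
  ≤-by-slack (q * (x′ - x) + (1ℚ - q) * (y′ - y))
    (solve 5 (λ q x x′ y y′ → (q :* x′ :+ (con 1ℚ :- q) :* y′) :- (q :* x :+ (con 1ℚ :- q) :* y)
                              := q :* (x′ :- x) :+ (con 1ℚ :- q) :* (y′ :- y)) refl q x x′ y y′)
    (0≤+ (0≤* 0≤q (p≤q⇒0≤q-p x≤x′)) (0≤* (p≤q⇒0≤q-p q≤1) (p≤q⇒0≤q-p y≤y′)))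

expect-suc : ∀ {n} (p : Fin (suc n) → ℚ) (f : Subset (suc n) → ℚ) →
  expect p f ≡ mix (p Fin.zero) (expect (p ∘ Fin.suc) (f ∘ (true ∷_))) (expect (p ∘ Fin.suc) (f ∘ (false ∷_)))
expect-suc {n} p f = begin
  sumℚ (map term (map (true ∷_) subsets ++ map (false ∷_) subsets))
    ≡⟨ cong sumℚ (ListP.map-++ term (map (true ∷_) subsets) (map (false ∷_) subsets)) ⟩
  sumℚ (map term (map (true ∷_) subsets) ++ map term (map (false ∷_) subsets))
    ≡⟨ sumℚ-++ (map term (map (true ∷_) subsets)) (map term (map (false ∷_) subsets)) ⟩
  sumℚ (map term (map (true ∷_) subsets)) + sumℚ (map term (map (false ∷_) subsets))
    ≡⟨ cong₂ _+_ (branch true) (branch false) ⟩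
  mix (p Fin.zero) (expect (p ∘ Fin.suc) (f ∘ (true ∷_))) (expect (p ∘ Fin.suc) (f ∘ (false ∷_))) ∎
  where
  open ≡-Reasoning
  subsets : List (Subset n)
  subsets = allSubsets n
  term : Subset (suc n) → ℚ
  term A = probExactly p A * f A
  weight : Bool → ℚ
  weight b = if b then p Fin.zero else 1ℚ - p Fin.zero
  branch : ∀ b → sumℚ (map term (map (b ∷_) subsets)) ≡ weight b * expect (p ∘ Fin.suc) (f ∘ (b ∷_))
  branch b = begin
    sumℚ (map term (map (b ∷_) subsets))
      ≡⟨ cong sumℚ (sym (ListP.map-∘ subsets)) ⟩
    sumℚ (map (λ A → (weight b * probExactly (p ∘ Fin.suc) A) * f (b ∷ A)) subsets)
      ≡⟨ cong sumℚ (ListP.map-cong (λ A → ℚP.*-assoc (weight b) _ _) subsets) ⟩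
    sumℚ (map (λ A → weight b * (probExactly (p ∘ Fin.suc) A * f (b ∷ A))) subsets)
      ≡⟨ sumℚ-*ˡ (weight b) (λ A → probExactly (p ∘ Fin.suc) A * f (b ∷ A)) subsets ⟩
    weight b * expect (p ∘ Fin.suc) (f ∘ (b ∷_)) ∎

expect-cong : ∀ {n} (p : Fin n → ℚ) {f g : Subset n → ℚ} → (∀ A → f A ≡ g A) → expect p f ≡ expect p g
expect-cong {n} p f≗g = cong sumℚ (ListP.map-cong (λ A → cong (probExactly p A *_) (f≗g A)) (allSubsets n))

expect-affine : ∀ {n} (p : Fin n → ℚ) a b (f : Subset n → ℚ) →
  expect p (λ A → a * f A + b) ≡ a * expect p f + b
expect-affine {zero} p a b f =
  solve 3 (λ a b x → con 1ℚ :* (a :* x :+ b) :+ con 0ℚ := a :* (con 1ℚ :* x :+ con 0ℚ) :+ b) refl a b (f [])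
expect-affine {suc n} p a b f = begin
  expect p (λ A → a * f A + b)
    ≡⟨ expect-suc p _ ⟩
  mix q (expect p′ (λ A → a * f (true ∷ A) + b)) (expect p′ (λ A → a * f (false ∷ A) + b))
    ≡⟨ cong₂ (mix q) (expect-affine p′ a b (f ∘ (true ∷_))) (expect-affine p′ a b (f ∘ (false ∷_))) ⟩
  mix q (a * x + b) (a * y + b)
    ≡⟨ solve 5 (λ q a b x y → q :* (a :* x :+ b) :+ (con 1ℚ :- q) :* (a :* y :+ b)
                              := a :* (q :* x :+ (con 1ℚ :- q) :* y) :+ b) refl q a b x y ⟩
  a * mix q x y + b
    ≡⟨ cong (λ e → a * e + b) (sym (expect-suc p f)) ⟩
  a * expect p f + b ∎
  where
  open ≡-Reasoning
  q : ℚ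
  q = p Fin.zero
  p′ : Fin n → ℚ
  p′ = p ∘ Fin.suc
  x y : ℚ
  x = expect p′ (f ∘ (true ∷_))
  y = expect p′ (f ∘ (false ∷_))

expect-*ˡ : ∀ {n} (p : Fin n → ℚ) a (f : Subset n → ℚ) → expect p (λ A → a * f A) ≡ a * expect p f
expect-*ˡ p a f = begin
  expect p (λ A → a * f A)        ≡⟨ expect-cong p (λ A → sym (ℚP.+-identityʳ (a * f A))) ⟩
  expect p (λ A → a * f A + 0ℚ)   ≡⟨ expect-affine p a 0ℚ f ⟩
  a * expect p f + 0ℚ             ≡⟨ ℚP.+-identityʳ (a * expect p f) ⟩
  a * expect p f                  ∎
  where open ≡-Reasoning

expect-+ˡ : ∀ {n} (p : Fin n → ℚ) b (f : Subset n → ℚ) → expect p (λ A → b + f A) ≡ b + expect p f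
expect-+ˡ p b f = begin
  expect p (λ A → b + f A)        ≡⟨ expect-cong p (λ A → solve 2 (λ b x → b :+ x := con 1ℚ :* x :+ b) refl b (f A)) ⟩
  expect p (λ A → 1ℚ * f A + b)   ≡⟨ expect-affine p 1ℚ b f ⟩
  1ℚ * expect p f + b             ≡⟨ solve 2 (λ b e → con 1ℚ :* e :+ b := b :+ e) refl b (expect p f) ⟩
  b + expect p f                  ∎
  where open ≡-Reasoning

expect-mono-≤ : ∀ {n} (p : Fin n → ℚ) → Probabilities p → {f g : Subset n → ℚ} →
  (∀ A → f A ≤ g A) → expect p f ≤ expect p g
expect-mono-≤ {zero} p _ f≤g = ℚP.+-monoˡ-≤ 0ℚ (ℚP.*-monoˡ-≤-nonNeg 1ℚ (f≤g []))
expect-mono-≤ {suc n} p probs {f} {g} f≤g =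
  subst₂ _≤_ (sym (expect-suc p f)) (sym (expect-suc p g))
    (mix-mono-≤ (proj₁ (probs Fin.zero)) (proj₂ (probs Fin.zero))
      (expect-mono-≤ (p ∘ Fin.suc) (probs ∘ Fin.suc) (f≤g ∘ (true ∷_)))
      (expect-mono-≤ (p ∘ Fin.suc) (probs ∘ Fin.suc) (f≤g ∘ (false ∷_))))

indicator : Bool → ℚ
indicator b = if b then 1ℚ else 0ℚ

-- Below the threshold t ≤ μ, the point x is even farther from μ than t is.
sq-gap-≤-indicator : ∀ {t μ} x → t ≤ μ → sq (μ - t) - sq (x - μ) ≤ sq (μ - t) * indicator (t ≤ᵇ x)
sq-gap-≤-indicator {t} {μ} x t≤μ with t ≤ᵇ x in t≤ᵇx
... | true = ≤-by-slack (sq (x - μ))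
  (solve 3 (λ t μ x → (μ :- t) :* (μ :- t) :* con 1ℚ :- ((μ :- t) :* (μ :- t) :- (x :- μ) :* (x :- μ))
                      := (x :- μ) :* (x :- μ)) refl t μ x)
  (0≤sq (x - μ))
... | false = ≤-by-slack (sq (t - x) + (+ 2 / 1) * (μ - t) * (t - x))
  (solve 3 (λ t μ x → (μ :- t) :* (μ :- t) :* con 0ℚ :- ((μ :- t) :* (μ :- t) :- (x :- μ) :* (x :- μ))
                      := (t :- x) :* (t :- x) :+ con (+ 2 / 1) :* (μ :- t) :* (t :- x)) refl t μ x)
  (0≤+ (0≤sq (t - x)) (0≤* (0≤* {+ 2 / 1} (ℚP.≤ᵇ⇒≤ _) (p≤q⇒0≤q-p t≤μ)) (p≤q⇒0≤q-p (ℚP.<⇒≤ x<t))))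
  where
  x<t : x < t
  x<t = ℚP.≰⇒> (λ t≤x → subst T t≤ᵇx (ℚP.≤⇒≤ᵇ t≤x))

second-moment-lower-tail : ∀ {n} (p : Fin n → ℚ) → Probabilities p → (f : Subset n → ℚ) {μ t : ℚ} → t ≤ μ →
  sq (μ - t) - expect p (λ A → sq (f A - μ)) ≤ sq (μ - t) * Pr p (λ A → t ≤ᵇ f A)
second-moment-lower-tail p probs f {μ} {t} t≤μ = begin
  c - expect p (λ A → sq (f A - μ))
    ≡⟨ solve 2 (λ c e → c :- e := con (- 1ℚ) :* e :+ c) refl c (expect p (λ A → sq (f A - μ))) ⟩
  (- 1ℚ) * expect p (λ A → sq (f A - μ)) + c
    ≡⟨ expect-affine p (- 1ℚ) c (λ A → sq (f A - μ)) ⟨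
  expect p (λ A → (- 1ℚ) * sq (f A - μ) + c)
    ≡⟨ expect-cong p (λ A → solve 2 (λ s c → con (- 1ℚ) :* s :+ c := c :- s) refl (sq (f A - μ)) c) ⟩
  expect p (λ A → c - sq (f A - μ))
    ≤⟨ expect-mono-≤ p probs (λ A → sq-gap-≤-indicator (f A) t≤μ) ⟩
  expect p (λ A → c * indicator (t ≤ᵇ f A))
    ≡⟨ expect-*ˡ p c (λ A → indicator (t ≤ᵇ f A)) ⟩
  c * Pr p (λ A → t ≤ᵇ f A) ∎
  where
  open ℚP.≤-Reasoning
  c : ℚ
  c = sq (μ - t)

-- Counting the active elements of a fixed set

mass : ∀ {n} → (Fin n → ℚ) → Subset n → ℚ
mass {zero} p [] = 0ℚ
mass {suc n} p (b ∷ H) = (if b then p Fin.zero else 0ℚ) + mass (p ∘ Fin.suc) H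

count : ∀ {n} → Subset n → Subset n → ℚ
count H A = ℕ→ℚ ∣ A ∩ H ∣

expect-count : ∀ {n} (p : Fin n → ℚ) (H : Subset n) → expect p (count H) ≡ mass p H
expect-count {zero} p [] = refl
expect-count {suc n} p (true ∷ H) = begin
  expect p (count (true ∷ H))
    ≡⟨ expect-suc p (count (true ∷ H)) ⟩
  mix q (expect p′ (λ A → ℕ→ℚ (suc ∣ A ∩ H ∣))) (expect p′ (count H))
    ≡⟨ cong (λ e → mix q e (expect p′ (count H))) (expect-cong p′ (λ A → ℕ→ℚ-suc ∣ A ∩ H ∣)) ⟩
  mix q (expect p′ (λ A → 1ℚ + count H A)) (expect p′ (count H))
    ≡⟨ cong (λ e → mix q e (expect p′ (count H))) (expect-+ˡ p′ 1ℚ (count H)) ⟩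
  mix q (1ℚ + expect p′ (count H)) (expect p′ (count H))
    ≡⟨ cong (λ e → mix q (1ℚ + e) e) (expect-count p′ H) ⟩
  mix q (1ℚ + mass p′ H) (mass p′ H)
    ≡⟨ solve 2 (λ q s → q :* (con 1ℚ :+ s) :+ (con 1ℚ :- q) :* s := q :+ s) refl q (mass p′ H) ⟩
  q + mass p′ H ∎
  where
  open ≡-Reasoning
  q : ℚ
  q = p Fin.zero
  p′ : Fin n → ℚ
  p′ = p ∘ Fin.suc
expect-count {suc n} p (false ∷ H) = begin
  expect p (count (false ∷ H))
    ≡⟨ expect-suc p (count (false ∷ H)) ⟩
  mix q (expect p′ (count H)) (expect p′ (count H))
    ≡⟨ cong (λ e → mix q e e) (expect-count p′ H) ⟩
  mix q (mass p′ H) (mass p′ H)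
    ≡⟨ solve 2 (λ q s → q :* s :+ (con 1ℚ :- q) :* s := con 0ℚ :+ s) refl q (mass p′ H) ⟩
  0ℚ + mass p′ H ∎
  where
  open ≡-Reasoning
  q : ℚ
  q = p Fin.zero
  p′ : Fin n → ℚ
  p′ = p ∘ Fin.suc

-- The centre m is arbitrary because an active element of H shifts the centre for the
-- remaining elements by one; each element of H contributes slack p_i², as its variance
-- is p_i(1 - p_i) ≤ p_i.
expect-sq-count-≤ : ∀ {n} (p : Fin n → ℚ) → Probabilities p → (H : Subset n) (m : ℚ) →
  expect p (λ A → sq (count H A - m)) ≤ mass p H + sq (mass p H - m)
expect-sq-count-≤ {zero} p _ [] m = ℚP.≤-reflexive
  (solve 1 (λ m → con 1ℚ :* ((con 0ℚ :- m) :* (con 0ℚ :- m)) :+ con 0ℚ := con 0ℚ :+ (con 0ℚ :- m) :* (con 0ℚ :- m)) refl m)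
expect-sq-count-≤ {suc n} p probs (false ∷ H) m = begin
  expect p (λ A → sq (count (false ∷ H) A - m))
    ≡⟨ expect-suc p (λ A → sq (count (false ∷ H) A - m)) ⟩
  mix q (expect p′ (λ A → sq (count H A - m))) (expect p′ (λ A → sq (count H A - m)))
    ≤⟨ mix-mono-≤ 0≤q q≤1 (expect-sq-count-≤ p′ probs′ H m) (expect-sq-count-≤ p′ probs′ H m) ⟩
  mix q (s + sq (s - m)) (s + sq (s - m))
    ≡⟨ solve 3 (λ q s m → q :* (s :+ (s :- m) :* (s :- m)) :+ (con 1ℚ :- q) :* (s :+ (s :- m) :* (s :- m))
                          := con 0ℚ :+ s :+ (con 0ℚ :+ s :- m) :* (con 0ℚ :+ s :- m)) refl q s m ⟩
  (0ℚ + s) + sq ((0ℚ + s) - m) ∎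
  where
  open ℚP.≤-Reasoning
  q : ℚ
  q = p Fin.zero
  0≤q : 0ℚ ≤ q
  0≤q = proj₁ (probs Fin.zero)
  q≤1 : q ≤ 1ℚ
  q≤1 = proj₂ (probs Fin.zero)
  p′ : Fin n → ℚ
  p′ = p ∘ Fin.suc
  probs′ : Probabilities p′
  probs′ = probs ∘ Fin.suc
  s : ℚ
  s = mass p′ H
expect-sq-count-≤ {suc n} p probs (true ∷ H) m = begin
  expect p (λ A → sq (count (true ∷ H) A - m))
    ≡⟨ expect-suc p (λ A → sq (count (true ∷ H) A - m)) ⟩
  mix q (expect p′ (λ A → sq (ℕ→ℚ (suc ∣ A ∩ H ∣) - m))) (expect p′ (λ A → sq (count H A - m)))
    ≡⟨ cong (λ e → mix q e (expect p′ (λ A → sq (count H A - m)))) (expect-cong p′ shift) ⟩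
  mix q (expect p′ (λ A → sq (count H A - (m - 1ℚ)))) (expect p′ (λ A → sq (count H A - m)))
    ≤⟨ mix-mono-≤ 0≤q q≤1 (expect-sq-count-≤ p′ probs′ H (m - 1ℚ)) (expect-sq-count-≤ p′ probs′ H m) ⟩
  mix q (s + sq (s - (m - 1ℚ))) (s + sq (s - m))
    ≤⟨ ≤-by-slack (sq q)
         (solve 3 (λ q s m → (q :+ s :+ (q :+ s :- m) :* (q :+ s :- m))
                             :- (q :* (s :+ (s :- (m :- con 1ℚ)) :* (s :- (m :- con 1ℚ))) :+ (con 1ℚ :- q) :* (s :+ (s :- m) :* (s :- m)))
                             := q :* q) refl q s m)
         (0≤sq q) ⟩
  (q + s) + sq ((q + s) - m) ∎
  where
  open ℚP.≤-Reasoning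
  q : ℚ
  q = p Fin.zero
  0≤q : 0ℚ ≤ q
  0≤q = proj₁ (probs Fin.zero)
  q≤1 : q ≤ 1ℚ
  q≤1 = proj₂ (probs Fin.zero)
  p′ : Fin n → ℚ
  p′ = p ∘ Fin.suc
  probs′ : Probabilities p′
  probs′ = probs ∘ Fin.suc
  s : ℚ
  s = mass p′ H
  shift : ∀ A → sq (ℕ→ℚ (suc ∣ A ∩ H ∣) - m) ≡ sq (count H A - (m - 1ℚ))
  shift A rewrite ℕ→ℚ-suc ∣ A ∩ H ∣ =
    solve 2 (λ x m → (con 1ℚ :+ x :- m) :* (con 1ℚ :+ x :- m) := (x :- (m :- con 1ℚ)) :* (x :- (m :- con 1ℚ))) refl (count H A) m

½≤Pr[t≤count] : ∀ {n} (p : Fin n → ℚ) → Probabilities p → (H : Subset n) {t : ℚ} →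
  0ℚ < t → t ≤ mass p H → (+ 2 / 1) * mass p H ≤ sq (mass p H - t) →
  ½ ≤ Pr p (λ A → t ≤ᵇ count H A)
½≤Pr[t≤count] p probs H {t} 0<t t≤μ 2μ≤c = ℚP.*-cancelˡ-≤-pos c {{ℚ.positive 0<c}} (begin
  c * ½
    ≤⟨ ≤-by-slack (½ * (c - (+ 2 / 1) * μ))
         (solve 2 (λ c μ → c :- μ :- c :* con ½ := con ½ :* (c :- con (+ 2 / 1) :* μ)) refl c μ)
         (0≤* {½} (ℚP.≤ᵇ⇒≤ _) (p≤q⇒0≤q-p 2μ≤c)) ⟩
  c - μ
    ≡⟨ solve 2 (λ c μ → c :- μ := c :- (μ :+ (μ :- μ) :* (μ :- μ))) refl c μ ⟩
  c - (μ + sq (μ - μ))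
    ≤⟨ ℚP.+-monoʳ-≤ c (ℚP.neg-antimono-≤ (expect-sq-count-≤ p probs H μ)) ⟩
  c - expect p (λ A → sq (count H A - μ))
    ≤⟨ second-moment-lower-tail p probs (count H) t≤μ ⟩
  c * Pr p (λ A → t ≤ᵇ count H A) ∎)
  where
  open ℚP.≤-Reasoning
  μ : ℚ
  μ = mass p H
  c : ℚ
  c = sq (μ - t)
  0<c : 0ℚ < c
  0<c = ℚP.<-≤-trans (ℚP.*-monoʳ-<-pos (+ 2 / 1) (ℚP.<-≤-trans 0<t t≤μ)) 2μ≤c

mass-tabulate : ∀ {n} (p : Fin n → ℚ) (g : Fin n → Bool) →
  sumℚ (List.tabulate (λ i → if g i then p i else 0ℚ)) ≡ mass p (Vec.tabulate g)
mass-tabulate {zero} p g = refl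
mass-tabulate {suc n} p g =
  cong (λ s → (if g Fin.zero then p Fin.zero else 0ℚ) + s) (mass-tabulate (p ∘ Fin.suc) (g ∘ Fin.suc))

prefixSum≡mass-prefixSet : ∀ {n} (p : Fin n → ℚ) m → prefixSum p m ≡ mass p (prefixSet n m)
prefixSum≡mass-prefixSet p m =
  trans (cong sumℚ (ListP.map-tabulate id (λ i → if toℕ i <ᵇ m then p i else 0ℚ))) (mass-tabulate p (λ i → toℕ i <ᵇ m))

mass-prefixSet-suc≤ : ∀ {n} (p : Fin n → ℚ) → Probabilities p → ∀ m →
  mass p (prefixSet n (suc m)) ≤ mass p (prefixSet n m) + 1ℚ
mass-prefixSet-suc≤ {zero} p _ m = ℚP.≤ᵇ⇒≤ _
mass-prefixSet-suc≤ {suc n} p probs zero = ≤-by-slack (1ℚ - p Fin.zero)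
  (solve 2 (λ q s → ((con 0ℚ :+ s) :+ con 1ℚ) :- (q :+ s) := con 1ℚ :- q) refl (p Fin.zero) (mass (p ∘ Fin.suc) (prefixSet n 0)))
  (p≤q⇒0≤q-p (proj₂ (probs Fin.zero)))
mass-prefixSet-suc≤ {suc n} p probs (suc m) = ℚP.≤-trans
  (ℚP.+-monoʳ-≤ (p Fin.zero) (mass-prefixSet-suc≤ (p ∘ Fin.suc) (probs ∘ Fin.suc) m))
  (ℚP.≤-reflexive (sym (ℚP.+-assoc (p Fin.zero) (mass (p ∘ Fin.suc) (prefixSet n m)) 1ℚ)))

prefixSum-suc≤ : ∀ {n} (p : Fin n → ℚ) → Probabilities p → ∀ m → prefixSum p (suc m) ≤ prefixSum p m + 1ℚ
prefixSum-suc≤ p probs m rewrite prefixSum≡mass-prefixSet p m | prefixSum≡mass-prefixSet p (suc m) =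
  mass-prefixSet-suc≤ p probs m

prefixSet-self≡⊤ : ∀ n → prefixSet n n ≡ ⊤
prefixSet-self≡⊤ zero = refl
prefixSet-self≡⊤ (suc n) = cong (true ∷_) (prefixSet-self≡⊤ n)

maxFin-lub : ∀ k (f : Fin k → ℕ) {b} → (∀ i → f i ℕ.≤ b) → maxFin k f ℕ.≤ b
maxFin-lub zero f _ = ℕ.z≤n
maxFin-lub (suc k) f f≤b = ℕP.⊔-lub (f≤b Fin.zero) (maxFin-lub k (f ∘ Fin.suc) (f≤b ∘ Fin.suc))

value≤prefixSum-all : ∀ {n k r} (p : Fin n → ℚ) → Probabilities p → (P : Portfolio n k r) → value p P ≤ prefixSum p n
value≤prefixSum-all {n} {k} p probs P = begin
  value p P
    ≤⟨ expect-mono-≤ p probs (λ A → ℕ→ℚ-mono-≤ (maxFin-lub k _ (λ i → caught≤active i A))) ⟩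
  expect p (count ⊤)          ≡⟨ expect-count p ⊤ ⟩
  mass p ⊤                    ≡⟨ cong (mass p) (prefixSet-self≡⊤ n) ⟨
  mass p (prefixSet n n)      ≡⟨ prefixSum≡mass-prefixSet p n ⟨
  prefixSum p n               ∎
  where
  open ℚP.≤-Reasoning
  caught≤active : ∀ i A → ∣ proj₁ P i ∩ A ∣ ℕ.≤ ∣ A ∩ ⊤ ∣
  caught≤active i A rewrite ∩-identityʳ A = ∣p∩q∣≤∣q∣ (proj₁ P i) A

½*p≤p : ∀ {p} → 0ℚ ≤ p → ½ * p ≤ p
½*p≤p {p} 0≤p = ≤-by-slack (½ * p) (solve 1 (λ p → p :- con ½ :* p := con ½ :* p) refl p) (0≤* {½} (ℚP.≤ᵇ⇒≤ _) 0≤p)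

0<o/12 : ∀ {o} → ℕ→ℚ 200 ≤ o → 0ℚ < (+ 1 / 12) * o
0<o/12 200≤o = ℚP.*-monoʳ-<-pos (+ 1 / 12) (ℚP.<-≤-trans (ℚP.positive⁻¹ (ℕ→ℚ 200)) 200≤o)

module _ {μ o : ℚ} (200≤o : ℕ→ℚ 200 ≤ o) (½o≤μ+1 : ½ * o ≤ μ + 1ℚ) where
  private
    u v w : ℚ
    u = μ + 1ℚ - ½ * o
    v = o - ℕ→ℚ 200
    w = u + (+ 5 / 12) * v
    0≤w : 0ℚ ≤ w
    0≤w = 0≤+ (p≤q⇒0≤q-p ½o≤μ+1) (0≤* {+ 5 / 12} (ℚP.≤ᵇ⇒≤ _) (p≤q⇒0≤q-p 200≤o))

  o/12≤μ : (+ 1 / 12) * o ≤ μ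
  o/12≤μ = ≤-by-slack (w + (+ 247 / 3))
    (solve 2 (λ μ o → μ :- con (+ 1 / 12) :* o
                      := ((μ :+ con 1ℚ :- con ½ :* o) :+ con (+ 5 / 12) :* (o :- con (ℕ→ℚ 200))) :+ con (+ 247 / 3)) refl μ o)
    (0≤+ 0≤w (ℚP.≤ᵇ⇒≤ _))

  2μ≤sq[μ-o/12] : (+ 2 / 1) * μ ≤ sq (μ - (+ 1 / 12) * o)
  2μ≤sq[μ-o/12] = ≤-by-slack (sq w + (+ 488 / 3) * u + (+ 1217 / 18) * v + (+ 59227 / 9))
    (solve 2 (λ μ o → (μ :- con (+ 1 / 12) :* o) :* (μ :- con (+ 1 / 12) :* o) :- con (+ 2 / 1) :* μ
                      := ((μ :+ con 1ℚ :- con ½ :* o) :+ con (+ 5 / 12) :* (o :- con (ℕ→ℚ 200)))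
                           :* ((μ :+ con 1ℚ :- con ½ :* o) :+ con (+ 5 / 12) :* (o :- con (ℕ→ℚ 200)))
                         :+ con (+ 488 / 3) :* (μ :+ con 1ℚ :- con ½ :* o)
                         :+ con (+ 1217 / 18) :* (o :- con (ℕ→ℚ 200)) :+ con (+ 59227 / 9)) refl μ o)
    (0≤+ (0≤+ (0≤+ (0≤sq w) (0≤* {+ 488 / 3} (ℚP.≤ᵇ⇒≤ _) (p≤q⇒0≤q-p ½o≤μ+1)))
                   (0≤* {+ 1217 / 18} (ℚP.≤ᵇ⇒≤ _) (p≤q⇒0≤q-p 200≤o)))
         (ℚP.≤ᵇ⇒≤ _))

lemma4p3 : (n r k : ℕ) (p : Fin n → ℚ) →
    r ℕ.≤ n → 1 ℕ.≤ k →
    (∀ i → (0ℚ ℚ.≤ p i) × (p i ℚ.≤ 1ℚ)) →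
    (∀ i j → i Fin.≤ j → p j ℚ.≤ p i) →
    (OPT : ℚ) → IsOPT n k r p OPT → ℕ→ℚ 200 ℚ.≤ OPT →
    (M* : ℕ) → M* ℕ.≤ n → prefixSum p M* ℚ.< ½ * OPT →
    (∀ m → M* ℕ.< m → m ℕ.≤ n → ¬ (prefixSum p m ℚ.< ½ * OPT)) →
    ½ ℚ.≤ Pr p (λ A → (+ 1 / 12) * OPT ≤ᵇ ℕ→ℚ ∣ A ∩ prefixSet n M* ∣)
lemma4p3 n _ _ p _ _ probs _ OPT ((P , valueP≡OPT) , _) 200≤OPT M* M*≤n prefix<½OPT maximal =
  ½≤Pr[t≤count] p probs H (0<o/12 200≤OPT) (o/12≤μ {μ} 200≤OPT ½OPT≤μ+1) (2μ≤sq[μ-o/12] {μ} 200≤OPT ½OPT≤μ+1)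
  where
  H : Subset n
  H = prefixSet n M*
  μ : ℚ
  μ = mass p H
  OPT≤prefixSum-all : OPT ≤ prefixSum p n
  OPT≤prefixSum-all = subst (_≤ prefixSum p n) valueP≡OPT (value≤prefixSum-all p probs P)
  M*<n : M* ℕ.< n
  M*<n = ℕP.≤∧≢⇒< M*≤n λ { refl → ℚP.<-irrefl refl
    (ℚP.<-≤-trans prefix<½OPT (ℚP.≤-trans (½*p≤p (ℚP.≤-trans (0≤ℕ→ℚ 200) 200≤OPT)) OPT≤prefixSum-all)) }
  ½OPT≤μ+1 : ½ * OPT ≤ μ + 1ℚ
  ½OPT≤μ+1 = subst (λ s → ½ * OPT ≤ s + 1ℚ) (prefixSum≡mass-prefixSet p M*)
    (ℚP.≤-trans (ℚP.≮⇒≥ (maximal (suc M*) (ℕP.n<1+n M*) M*<n)) (prefixSum-suc≤ p probs M*))
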